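{- In MMB, for every $k\ge1$, with $d=\lfloor\log_2(k+1)\rfloor$, the amortized number of belt-node ancestors of the $k$-th newest leaf is $$\bar b(k)=\begin{cases}\frac38d+\dfrac{k+1}{2^{d+1}}+\dfrac18 & \text{if } 2^d\le k+1\le\frac32 2^d,\\[2mm] \frac38d+\dfrac{k+1}{2^{d+2}}+\dfrac12 & \text{if } \frac32 2^d<k+1<2^{d+1},\end{cases}$$ where $\bar b(k):=\lim_{N\to\infty}\frac1N\sum_{n=k}^{k+N-1}b(k,n)$.
   Context: A mountain of height $s\ge0$ is a perfect binary tree with $2^s$ leaves; its root is its peak. The U-MMB with $n$ leaves is an ordered (left-to-right) list of mountains whose leaves read left to right are $h_1,\dots,h_n$, built inductively from the empty list: the $n$-th append (1) adds $h_n$ as a height-0 mountain at the right end, and (2) if there exist two consecutive mountains of equal height, takes the rightmost such pair, of height $s$, and replaces it in place by a mountain of height $s+1$ whose new peak has the two old peaks as children. MMB partitions the mountains into ranges: consecutive mountains $M,M'$ ($M$ left of $M'$) are in different ranges iff their heights differ by 2, or the mountain immediately left of $M$ exists and has the same height as $M$. For a range with peaks $P_1,\dots,P_r$, range nodes are $R_1$ (single child $P_1$) and $R_j$ with children $R_{j-1},P_j$; $R_r$ is the range root. For range roots $Q_1,\dots,Q_q$ (left to right), belt nodes are $B_1$ (single child $Q_1$) and $B_j$ with children $B_{j-1},Q_j$; $B_q$ is the root. For $1\le k\le n$, $b(k,n)$ is the number of ancestors of $h_{n-k+1}$ that are belt nodes in the MMB with $n$ leaves. -}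

module Defs where

open import Data.Nat using (ℕ; zero; suc; _+_; _*_; _∸_; _^_; _≡ᵇ_)
open import Data.Bool using (Bool; true; false; if_then_else_; _∨_)
open import Data.List using (List; []; _∷_; [_]; _++_; map; reverse; upTo)
open import Data.Nat.ListAction using (sum)
open import Data.Maybe using (Maybe; just; nothing)
open import Data.Integer using (ℤ; +_)
open import Data.Rational using (ℚ; _<_; _-_; ∣_∣; 0ℚ)
open import Data.Product using (Σ; _×_)

-- U-MMB as the list of mountain heights.
-- We store the list RIGHT-TO-LEFT (head = rightmost mountain).

mergeRightmost : List ℕ → List ℕ
mergeRightmost (x ∷ y ∷ r) =
  if x ≡ᵇ y then suc x ∷ r else x ∷ mergeRightmost (y ∷ r)
mergeRightmost l = l

ummbRev : ℕ → List ℕ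
ummbRev zero    = []
ummbRev (suc n) = mergeRightmost (0 ∷ ummbRev n)

ummb : ℕ → List ℕ
ummb n = reverse (ummbRev n)

differBy2 : ℕ → ℕ → Bool
differBy2 x y = (x ≡ᵇ y + 2) ∨ (y ≡ᵇ x + 2)

sameAsLeft : Maybe ℕ → ℕ → Bool
sameAsLeft nothing  x = false
sameAsLeft (just p) x = p ≡ᵇ x

-- M = x, M' = y, p = height of the mountain immediately left of M (if any)
cut : Maybe ℕ → ℕ → ℕ → Bool
cut p x y = differBy2 x y ∨ sameAsLeft p x

addFront : Bool → ℕ → List (List ℕ) → List (List ℕ)
addFront true  x gs       = [ x ] ∷ gs
addFront false x []       = [ x ] ∷ []
addFront false x (g ∷ gs) = (x ∷ g) ∷ gs

ranges′ : Maybe ℕ → List ℕ → List (List ℕ)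
ranges′ p []          = []
ranges′ p (x ∷ [])    = [ x ∷ [] ]
ranges′ p (x ∷ y ∷ r) = addFront (cut p x y) x (ranges′ (just x) (y ∷ r))

ranges : List ℕ → List (List ℕ)
ranges = ranges′ nothing

data Tree : Set where
  leaf   : Tree
  mnode  : Tree → Tree → Tree
  rnode1 : Tree → Tree
  rnode2 : Tree → Tree → Tree      -- Rⱼ, children Rⱼ₋₁ and Pⱼ
  bnode1 : Tree → Tree
  bnode2 : Tree → Tree → Tree      -- Bⱼ, children Bⱼ₋₁ and Qⱼ

mountain : ℕ → Tree
mountain zero    = leaf
mountain (suc s) = mnode (mountain s) (mountain s)

chainFrom : (Tree → Tree) → (Tree → Tree → Tree) → Tree → List Tree → Tree
chainFrom one two acc []       = acc
chainFrom one two acc (t ∷ ts) = chainFrom one two (two acc t) ts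

chain : (Tree → Tree) → (Tree → Tree → Tree) → List Tree → Maybe Tree
chain one two []       = nothing
chain one two (t ∷ ts) = just (chainFrom one two (one t) ts)

rangeRoot : List ℕ → Maybe Tree
rangeRoot hs = chain rnode1 rnode2 (map mountain hs)

catMaybes : List (Maybe Tree) → List Tree
catMaybes []             = []
catMaybes (nothing ∷ xs) = catMaybes xs
catMaybes (just x ∷ xs)  = x ∷ catMaybes xs

mmb : ℕ → Maybe Tree
mmb n = chain bnode1 bnode2 (catMaybes (map rangeRoot (ranges (ummb n))))

beltCounts : Tree → List ℕ
beltCounts leaf         = [ 0 ]
beltCounts (mnode l r)  = beltCounts l ++ beltCounts r
beltCounts (rnode1 t)   = beltCounts t
beltCounts (rnode2 l r) = beltCounts l ++ beltCounts r
beltCounts (bnode1 t)   = map suc (beltCounts t)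
beltCounts (bnode2 l r) = map suc (beltCounts l ++ beltCounts r)

beltCountsM : Maybe Tree → List ℕ
beltCountsM nothing  = []
beltCountsM (just t) = beltCounts t

-- 0-based lookup with default 0
nth : List ℕ → ℕ → ℕ
nth []       i       = 0
nth (x ∷ xs) zero    = x
nth (x ∷ xs) (suc i) = nth xs i

-- b(k,n): belt ancestors of h_{n-k+1} (0-based index n-k), for 1 ≤ k ≤ n
b : ℕ → ℕ → ℕ
b k n = nth (beltCountsM (mmb n)) (n ∸ k)

partialSum : ℕ → ℕ → ℕ
partialSum k N = sum (map (λ i → b k (k + i)) (upTo N))

average : ℕ → ℕ → ℚ
average k m = Data.Rational._/_ (+ partialSum k (suc m)) (suc m)

AmortizedLimit : ℕ → ℚ → Set
AmortizedLimit k L =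
  (ε : ℚ) → 0ℚ < ε →
  Σ ℕ λ M → (m : ℕ) → M Data.Nat.≤ m → ∣ average k m - L ∣ < ε

-- The U-MMB with n leaves is a binary counter for n + 1: reading right to left, its i-th mountain
-- (from 0) has height i + (the i-th binary digit of n + 1). Whether two neighbouring mountains lie in
-- different ranges depends only on three consecutive digits, and exactly three of the eight digit
-- patterns produce a range boundary. Every leaf of a range has one belt ancestor per range from its
-- own to the rightmost one. If 2^d ≤ k + 1 < 2^(d+1), the k-th newest leaf lies in mountain d - 1 or d,
-- so once n + 1 ≥ 2^(d+2) its belt count is a function of n + 1 modulo 2^(d+2). The amortized value is
-- therefore the average over one period: each of the d - 1 far boundaries contributes 3/8, and the
-- boundary between mountains d and d - 1 counts exactly for those n for which the leaf lies in
-- mountain d, which produces the term depending on k.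
module Submission where

open import Data.Bool using (Bool; true; false; if_then_else_)
open import Data.Bool.Properties using (if-float)
open import Data.List using (List; []; _∷_; _++_; map; length; replicate; reverse; applyUpTo; applyDownFrom)
open import Data.List.Properties
  using ( map-upTo; map-applyUpTo; reverse-applyUpTo; map-++; map-∘; map-cong; map-id; map-replicate
        ; ++-assoc; ++-identityʳ)
open import Data.List.Relation.Unary.All using (All; []; _∷_)
open import Data.Maybe using (Maybe; just; nothing)
-- ℕ division is written _div_, leaving _/_ to the rationals of the statement.
open import Data.Nat hiding (_/_)
open import Data.Nat.DivMod hiding (_/_)
open import Data.Nat.Divisibility using (_∣_; divides; ∣n⇒∣m*n)
open import Data.Nat.ListAction using (sum)
open import Data.Nat.Properties
open import Algebra.Properties.CommutativeSemigroup +-commutativeSemigroup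
  using () renaming (interchange to +-interchange; x∙yz≈y∙xz to m+[n+o]≡n+[m+o])
open import Data.Nat.Tactic.RingSolver using (solve-∀)
open import Data.Product using (Σ; _×_; _,_; proj₁; proj₂; ∃)
open import Data.Sum using (inj₁; inj₂)
open import Function using (_∘_)
open import Relation.Binary.PropositionalEquality
open import Relation.Nullary using (¬_; yes; no; contradiction)
open import Relation.Nullary.Reflects using (ofʸ; ofⁿ)

open import Defs

-- Finite sums

toℕ : Bool → ℕ
toℕ false = 0
toℕ true  = 1

toℕ≤1 : ∀ c → toℕ c ≤ 1
toℕ≤1 false = z≤n
toℕ≤1 true  = s≤s z≤n

toℕ-<ᵇ-yes : ∀ {m n} → m < n → toℕ (m <ᵇ n) ≡ 1
toℕ-<ᵇ-yes {m} {n} m<n with m <ᵇ n | <ᵇ-reflects-< m n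
... | true  | _        = refl
... | false | ofⁿ m≮n = contradiction m<n m≮n

toℕ-<ᵇ-no : ∀ {m n} → ¬ m < n → toℕ (m <ᵇ n) ≡ 0
toℕ-<ᵇ-no {m} {n} m≮n with m <ᵇ n | <ᵇ-reflects-< m n
... | true  | ofʸ m<n = contradiction m<n m≮n
... | false | _       = refl

∑ : ℕ → (ℕ → ℕ) → ℕ
∑ zero    f = 0
∑ (suc n) f = f n + ∑ n f

syntax ∑ n (λ i → e) = ∑[ i < n ] e

∑-cong : ∀ n {f g : ℕ → ℕ} → (∀ i → i < n → f i ≡ g i) → ∑ n f ≡ ∑ n g
∑-cong zero    f≗g = refl
∑-cong (suc n) f≗g = cong₂ _+_ (f≗g n ≤-refl) (∑-cong n (λ i i<n → f≗g i (m≤n⇒m≤1+n i<n)))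

∑-+ : ∀ n (f g : ℕ → ℕ) → ∑[ i < n ] (f i + g i) ≡ ∑ n f + ∑ n g
∑-+ zero    f g = refl
∑-+ (suc n) f g = trans (cong (f n + g n +_) (∑-+ n f g)) (+-interchange (f n) (g n) (∑ n f) (∑ n g))

∑-suc : ∀ n (f : ℕ → ℕ) → ∑[ i < n ] suc (f i) ≡ n + ∑ n f
∑-suc zero    f = refl
∑-suc (suc n) f = cong suc (trans (cong (f n +_) (∑-suc n f)) (m+[n+o]≡n+[m+o] (f n) n (∑ n f)))

∑-const : ∀ n c → ∑[ i < n ] c ≡ n * c
∑-const zero    c = refl
∑-const (suc n) c = cong (c +_) (∑-const n c)

∑-*-zero : ∀ n (f : ℕ → ℕ) → ∑[ i < n ] (f i * 0) ≡ 0
∑-*-zero zero    f = refl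
∑-*-zero (suc n) f = cong₂ _+_ (*-zeroʳ (f n)) (∑-*-zero n f)

∑-≤ : ∀ n {f : ℕ → ℕ} {B} → (∀ i → f i ≤ B) → ∑ n f ≤ n * B
∑-≤ zero    f≤B = z≤n
∑-≤ (suc n) f≤B = +-mono-≤ (f≤B n) (∑-≤ n f≤B)

∑-swap : ∀ a b (f : ℕ → ℕ → ℕ) → ∑[ i < a ] ∑[ j < b ] f i j ≡ ∑[ j < b ] ∑[ i < a ] f i j
∑-swap zero    b f = sym (trans (∑-const b 0) (*-zeroʳ b))
∑-swap (suc a) b f =
  trans (cong (∑[ j < b ] f a j +_) (∑-swap a b f)) (sym (∑-+ b (f a) (λ j → ∑[ i < a ] f i j)))

∑-split : ∀ a b (f : ℕ → ℕ) → ∑ (a + b) f ≡ ∑ a f + ∑[ i < b ] f (a + i)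
∑-split a zero    f = trans (cong (λ n → ∑ n f) (+-identityʳ a)) (sym (+-identityʳ (∑ a f)))
∑-split a (suc b) f = begin
  ∑ (a + suc b) f                            ≡⟨ cong (λ n → ∑ n f) (+-suc a b) ⟩
  f (a + b) + ∑ (a + b) f                    ≡⟨ cong (f (a + b) +_) (∑-split a b f) ⟩
  f (a + b) + (∑ a f + ∑[ i < b ] f (a + i)) ≡⟨ m+[n+o]≡n+[m+o] (f (a + b)) (∑ a f) _ ⟩
  ∑ a f + ∑[ i < suc b ] f (a + i)           ∎
  where open ≡-Reasoning

∑-blocks : ∀ q X (f : ℕ → ℕ) → ∑ (q * X) f ≡ ∑[ j < q ] ∑[ x < X ] f (x + j * X)
∑-blocks zero    X f = refl
∑-blocks (suc q) X f = begin
  ∑ (X + q * X) f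
    ≡⟨ cong (λ n → ∑ n f) (+-comm X (q * X)) ⟩
  ∑ (q * X + X) f
    ≡⟨ ∑-split (q * X) X f ⟩
  ∑ (q * X) f + ∑[ x < X ] f (q * X + x)
    ≡⟨ +-comm (∑ (q * X) f) _ ⟩
  ∑[ x < X ] f (q * X + x) + ∑ (q * X) f
    ≡⟨ cong₂ _+_ (∑-cong X (λ x _ → cong f (+-comm (q * X) x))) (∑-blocks q X f) ⟩
  ∑[ j < suc q ] ∑[ x < X ] f (x + j * X) ∎
  where open ≡-Reasoning

∑-count-< : ∀ c T K → ∑[ x < T ] toℕ (c + x <ᵇ K) ≡ (K ∸ c) ⊓ T
∑-count-< c zero    K = sym (⊓-zeroʳ (K ∸ c))
∑-count-< c (suc T) K with c + T <ᵇ K | <ᵇ-reflects-< (c + T) K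
... | true  | ofʸ c+T<K = begin
  suc (∑[ x < T ] toℕ (c + x <ᵇ K)) ≡⟨ cong suc (∑-count-< c T K) ⟩
  suc ((K ∸ c) ⊓ T)                 ≡⟨ cong suc (m≥n⇒m⊓n≡n (<⇒≤ 1+T≤K∸c)) ⟩
  suc T                             ≡⟨ m≥n⇒m⊓n≡n 1+T≤K∸c ⟨
  (K ∸ c) ⊓ suc T                   ∎
  where
  open ≡-Reasoning
  1+T≤K∸c : suc T ≤ K ∸ c
  1+T≤K∸c = m+n≤o⇒m≤o∸n (suc T) (subst (_≤ K) (cong suc (+-comm c T)) c+T<K)
... | false | ofⁿ c+T≮K = begin
  ∑[ x < T ] toℕ (c + x <ᵇ K) ≡⟨ ∑-count-< c T K ⟩
  (K ∸ c) ⊓ T                 ≡⟨ m≤n⇒m⊓n≡m K∸c≤T ⟩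
  K ∸ c                       ≡⟨ m≤n⇒m⊓n≡m (m≤n⇒m≤1+n K∸c≤T) ⟨
  (K ∸ c) ⊓ suc T             ∎
  where
  open ≡-Reasoning
  K∸c≤T : K ∸ c ≤ T
  K∸c≤T = m≤n+o⇒m∸n≤o K c (≮⇒≥ c+T≮K)

sum-applyUpTo : ∀ n (f : ℕ → ℕ) → sum (applyUpTo f n) ≡ ∑ n f
sum-applyUpTo zero    f = refl
sum-applyUpTo (suc n) f = begin
  f 0 + sum (applyUpTo (f ∘ suc) n) ≡⟨ cong (f 0 +_) (sum-applyUpTo n (f ∘ suc)) ⟩
  f 0 + ∑[ i < n ] f (suc i)        ≡⟨ cong (_+ ∑[ i < n ] f (suc i)) (+-identityʳ (f 0)) ⟨
  (f 0 + 0) + ∑[ i < n ] f (suc i)  ≡⟨ ∑-split 1 n f ⟨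
  ∑ (suc n) f                       ∎
  where open ≡-Reasoning

partialSum≡∑ : ∀ k N → partialSum k N ≡ ∑[ i < N ] b k (k + i)
partialSum≡∑ k N = trans (cong sum (map-upTo (λ i → b k (k + i)) N)) (sum-applyUpTo N (λ i → b k (k + i)))

Periodic : ℕ → (ℕ → ℕ) → Set
Periodic P f = ∀ m → f (m + P) ≡ f m

∑-periodic-shift : ∀ {P f} → Periodic P f → ∀ a → ∑[ i < P ] f (a + i) ≡ ∑ P f
∑-periodic-shift         per zero    = refl
∑-periodic-shift {P} {f} per (suc a) = trans (+-cancelˡ-≡ (f a) _ _ shifted) (∑-periodic-shift per a)
  where
  open ≡-Reasoning
  shifted : f a + ∑[ i < P ] f (suc a + i) ≡ f a + ∑[ i < P ] f (a + i)
  shifted = begin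
    f a + ∑[ i < P ] f (suc a + i)
      ≡⟨ cong₂ _+_ (trans (+-identityʳ (f (a + 0))) (cong f (+-identityʳ a)))
                   (∑-cong P (λ i _ → cong f (+-suc a i))) ⟨
    (f (a + 0) + 0) + ∑[ i < P ] f (a + suc i)
      ≡⟨ ∑-split 1 P (λ i → f (a + i)) ⟨
    f (a + P) + ∑[ i < P ] f (a + i)
      ≡⟨ cong (_+ ∑[ i < P ] f (a + i)) (per a) ⟩
    f a + ∑[ i < P ] f (a + i) ∎

∑-periodic : ∀ {P f} → Periodic P f → ∀ a q → ∑[ i < q * P ] f (a + i) ≡ q * ∑ P f
∑-periodic         per a zero    = refl
∑-periodic {P} {f} per a (suc q) = begin
  ∑[ i < P + q * P ] f (a + i)
    ≡⟨ ∑-split P (q * P) (λ i → f (a + i)) ⟩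
  ∑[ i < P ] f (a + i) + ∑[ i < q * P ] f (a + (P + i))
    ≡⟨ cong₂ _+_ (∑-periodic-shift per a) (∑-cong (q * P) (λ i _ → cong f (sym (+-assoc a P i)))) ⟩
  ∑ P f + ∑[ i < q * P ] f (a + P + i)
    ≡⟨ cong (∑ P f +_) (∑-periodic per (a + P) q) ⟩
  ∑ P f + q * ∑ P f ∎
  where open ≡-Reasoning

∣m+n-o+p∣≤∣m-o∣+∣n-p∣ : ∀ m n o p → ∣ m + n - o + p ∣ ≤ ∣ m - o ∣ + ∣ n - p ∣
∣m+n-o+p∣≤∣m-o∣+∣n-p∣ m n o p = begin
  ∣ m + n - o + p ∣
    ≤⟨ ∣-∣-triangle (m + n) (o + n) (o + p) ⟩
  ∣ m + n - o + n ∣ + ∣ o + n - o + p ∣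
    ≡⟨ cong₂ _+_ (trans (cong₂ ∣_-_∣ (+-comm m n) (+-comm o n)) (∣m+n-m+o∣≡∣n-o∣ n m o))
                 (∣m+n-m+o∣≡∣n-o∣ o n p) ⟩
  ∣ m - o ∣ + ∣ n - p ∣ ∎
  where open ≤-Reasoning

periodic-deviation : ∀ {P f B} .{{_ : NonZero P}} → Periodic P f → (∀ m → f m ≤ B) →
                     ∀ a N → ∣ ∑[ i < N ] f (a + i) * P - N * ∑ P f ∣ ≤ P * B * P + P * ∑ P f
periodic-deviation {P} {f} {B} per f≤B a N = begin
  ∣ ∑[ i < N ] f (a + i) * P - N * C ∣
    ≡⟨ cong₂ (λ s n → ∣ s * P - n * C ∣) ∑≡R+q*C N≡r+q*P ⟩
  ∣ (R + q * C) * P - (r + q * P) * C ∣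
    ≡⟨ cong₂ ∣_-_∣ (rearrangeˡ R q C P) (rearrangeʳ r q C P) ⟩
  ∣ q * C * P + R * P - q * C * P + r * C ∣
    ≡⟨ ∣m+n-m+o∣≡∣n-o∣ (q * C * P) (R * P) (r * C) ⟩
  ∣ R * P - r * C ∣
    ≤⟨ ≤-trans (∣m-n∣≤m⊔n (R * P) (r * C)) (m⊔n≤m+n (R * P) (r * C)) ⟩
  R * P + r * C
    ≤⟨ +-mono-≤ (*-monoˡ-≤ P (≤-trans (∑-≤ r (λ i → f≤B (a + i))) (*-monoˡ-≤ B r≤P)))
                (*-monoˡ-≤ C r≤P) ⟩
  P * B * P + P * C ∎
  where
  open ≤-Reasoning
  C = ∑ P f
  r = N % P
  q = N div P
  R = ∑[ i < r ] f (a + i)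
  r≤P = <⇒≤ (m%n<n N P)
  N≡r+q*P : N ≡ r + q * P
  N≡r+q*P = m≡m%n+[m/n]*n N P
  ∑≡R+q*C : ∑[ i < N ] f (a + i) ≡ R + q * C
  ∑≡R+q*C = begin-equality
    ∑[ i < N ] f (a + i)
      ≡⟨ cong (λ n → ∑[ i < n ] f (a + i)) N≡r+q*P ⟩
    ∑[ i < r + q * P ] f (a + i)
      ≡⟨ ∑-split r (q * P) (λ i → f (a + i)) ⟩
    R + ∑[ i < q * P ] f (a + (r + i))
      ≡⟨ cong (R +_) (∑-cong (q * P) (λ i _ → cong f (sym (+-assoc a r i)))) ⟩
    R + ∑[ i < q * P ] f (a + r + i)
      ≡⟨ cong (R +_) (∑-periodic per (a + r) q) ⟩
    R + q * C ∎
  rearrangeˡ : ∀ R q C P → (R + q * C) * P ≡ q * C * P + R * P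
  rearrangeˡ = solve-∀
  rearrangeʳ : ∀ r q C P → (r + q * P) * C ≡ q * C * P + r * C
  rearrangeʳ = solve-∀

eventually-periodic-deviation : ∀ {P f B} .{{_ : NonZero P}} → Periodic P f → (∀ m → f m ≤ B) →
                                ∀ {g} N₀ a → (∀ i → g (N₀ + i) ≡ f (a + i)) →
                                ∃ λ K → ∀ N → N₀ ≤ N → ∣ ∑ N g * P - N * ∑ P f ∣ ≤ K
eventually-periodic-deviation {P} {f} {B} per f≤B {g} N₀ a g≡f =
  ∣ A * P - N₀ * C ∣ + (P * B * P + P * C) , deviation
  where
  C = ∑ P f
  A = ∑ N₀ g
  deviation : ∀ N → N₀ ≤ N → ∣ ∑ N g * P - N * C ∣ ≤ ∣ A * P - N₀ * C ∣ + (P * B * P + P * C)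
  deviation N N₀≤N = begin
    ∣ ∑ N g * P - N * C ∣
      ≡⟨ cong₂ (λ s n → ∣ s * P - n * C ∣) ∑≡A+S N≡N₀+N′ ⟩
    ∣ (A + S) * P - (N₀ + N′) * C ∣
      ≡⟨ cong₂ ∣_-_∣ (*-distribʳ-+ P A S) (*-distribʳ-+ C N₀ N′) ⟩
    ∣ A * P + S * P - N₀ * C + N′ * C ∣
      ≤⟨ ∣m+n-o+p∣≤∣m-o∣+∣n-p∣ (A * P) (S * P) (N₀ * C) (N′ * C) ⟩
    ∣ A * P - N₀ * C ∣ + ∣ S * P - N′ * C ∣
      ≤⟨ +-monoʳ-≤ ∣ A * P - N₀ * C ∣ (periodic-deviation per f≤B a N′) ⟩
    ∣ A * P - N₀ * C ∣ + (P * B * P + P * C) ∎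
    where
    open ≤-Reasoning
    N′ = N ∸ N₀
    S = ∑[ i < N′ ] f (a + i)
    N≡N₀+N′ : N ≡ N₀ + N′
    N≡N₀+N′ = sym (m+[n∸m]≡n N₀≤N)
    ∑≡A+S : ∑ N g ≡ A + S
    ∑≡A+S = trans (cong (λ n → ∑ n g) N≡N₀+N′)
                  (trans (∑-split N₀ N′ g) (cong (A +_) (∑-cong N′ (λ i _ → g≡f i))))

-- Binary digits

-- NonZero (2 ^ j) is provided locally throughout: a global instance for 2 ^ n would make
-- instance search for NonZero of other numbers ambiguous.
_%2^_ : ℕ → ℕ → ℕ
m %2^ j = m % 2 ^ j
  where instance _ = m^n≢0 2 j

bit : ℕ → ℕ → ℕ
bit i m = m div 2 ^ i % 2
  where instance _ = m^n≢0 2 i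

bit≤1 : ∀ i m → bit i m ≤ 1
bit≤1 i m = ≤-pred (m%n<n (m div 2 ^ i) 2)
  where instance _ = m^n≢0 2 i

bit-suc : ∀ i m → bit (suc i) m ≡ bit i (m div 2)
bit-suc i m = cong (_% 2) (sym (m/n/o≡m/[n*o] m 2 (2 ^ i)))
  where instance _ = m^n≢0 2 i; _ = m^n≢0 2 (suc i)

bit-zero-digit : ∀ {c} x → c ≤ 1 → bit 0 (c + x * 2) ≡ c
bit-zero-digit {c} x c≤1 = begin
  bit 0 (c + x * 2) ≡⟨ cong (_% 2) (n/1≡n (c + x * 2)) ⟩
  (c + x * 2) % 2   ≡⟨ [m+kn]%n≡m%n c x 2 ⟩
  c % 2             ≡⟨ m<n⇒m%n≡m (s≤s c≤1) ⟩
  c                 ∎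
  where open ≡-Reasoning

div2-digit : ∀ {c} x → c ≤ 1 → (c + x * 2) div 2 ≡ x
div2-digit {c} x c≤1 = begin
  (c + x * 2) div 2     ≡⟨ +-distrib-/-∣ʳ c (divides x refl) ⟩
  c div 2 + x * 2 div 2 ≡⟨ cong₂ _+_ (m<n⇒m/n≡0 (s≤s c≤1)) (m*n/n≡m x 2) ⟩
  x                     ∎
  where open ≡-Reasoning

bit-high : ∀ i j {x} y → x < 2 ^ i → bit (j + i) (x + y * 2 ^ i) ≡ bit j y
bit-high i j {x} y x<2^i = cong (_% 2) (begin
  (x + y * 2 ^ i) div 2 ^ (j + i)
    ≡⟨ /-congʳ (trans (cong (2 ^_) (+-comm j i)) (^-distribˡ-+-* 2 i j)) ⟩
  (x + y * 2 ^ i) div (2 ^ i * 2 ^ j)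
    ≡⟨ m/n/o≡m/[n*o] (x + y * 2 ^ i) (2 ^ i) (2 ^ j) ⟨
  (x + y * 2 ^ i) div 2 ^ i div 2 ^ j
    ≡⟨ cong (_div 2 ^ j) (+-distrib-/-∣ʳ x (divides y refl)) ⟩
  (x div 2 ^ i + y * 2 ^ i div 2 ^ i) div 2 ^ j
    ≡⟨ cong (λ z → (z + y * 2 ^ i div 2 ^ i) div 2 ^ j) (m<n⇒m/n≡0 x<2^i) ⟩
  y * 2 ^ i div 2 ^ i div 2 ^ j
    ≡⟨ cong (_div 2 ^ j) (m*n/n≡m y (2 ^ i)) ⟩
  y div 2 ^ j ∎)
  where
  open ≡-Reasoning
  instance _ = m^n≢0 2 i; _ = m^n≢0 2 j; _ = m^n≢0 2 (j + i); _ = m*n≢0 (2 ^ i) (2 ^ j)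

bit-below : ∀ {i x} → x < 2 ^ i → bit i x ≡ 0
bit-below {i} {x} x<2^i = trans (cong (bit i) (sym (+-identityʳ x))) (bit-high i 0 0 x<2^i)

bit-above : ∀ {i x} → x < 2 ^ i → bit i (2 ^ i + x) ≡ 1
bit-above {i} {x} x<2^i = trans (cong (bit i) (trans (+-comm (2 ^ i) x) (cong (x +_) (sym (+-identityʳ (2 ^ i))))))
                                (bit-high i 0 1 x<2^i)

2^m∣2^[m+n] : ∀ m n → 2 ^ m ∣ 2 ^ (m + n)
2^m∣2^[m+n] m n = divides (2 ^ n) (trans (^-distribˡ-+-* 2 m n) (*-comm (2 ^ m) (2 ^ n)))

bit-periodic : ∀ {j L} m q → j < L → bit j (m + q * 2 ^ L) ≡ bit j m
bit-periodic {j} {L} m q j<L = begin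
  bit j (m + q * 2 ^ L)                 ≡⟨ m%[n*o]/o≡m/o%n (m + q * 2 ^ L) 2 (2 ^ j) ⟨
  (m + q * 2 ^ L) % 2 ^ suc j div 2 ^ j ≡⟨ cong (_div 2 ^ j) (%-remove-+ʳ m 2^[1+j]∣q*2^L) ⟩
  m % 2 ^ suc j div 2 ^ j               ≡⟨ m%[n*o]/o≡m/o%n m 2 (2 ^ j) ⟩
  bit j m                               ∎
  where
  open ≡-Reasoning
  instance _ = m^n≢0 2 j; _ = m^n≢0 2 (suc j)
  2^[1+j]∣q*2^L : 2 ^ suc j ∣ q * 2 ^ L
  2^[1+j]∣q*2^L = subst (λ e → 2 ^ suc j ∣ q * 2 ^ e) (m+[n∸m]≡n j<L)
                    (∣n⇒∣m*n q (2^m∣2^[m+n] (suc j) (L ∸ suc j)))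

%2^-suc : ∀ j m → m %2^ suc j ≡ m %2^ j + bit j m * 2 ^ j
%2^-suc j m = begin
  r
    ≡⟨ m≡m%n+[m/n]*n r (2 ^ j) ⟩
  r % 2 ^ j + r div 2 ^ j * 2 ^ j
    ≡⟨ cong₂ (λ a b → a + b * 2 ^ j) (m∣n⇒o%n%m≡o%m (2 ^ j) (2 ^ suc j) m (divides 2 refl))
                                     (m%[n*o]/o≡m/o%n m 2 (2 ^ j)) ⟩
  m % 2 ^ j + bit j m * 2 ^ j ∎
  where
  open ≡-Reasoning
  instance _ = m^n≢0 2 j; _ = m^n≢0 2 (suc j)
  r = m % 2 ^ suc j

%2^-< : ∀ j m → m %2^ j < 2 ^ j
%2^-< j m = m%n<n m (2 ^ j)
  where instance _ = m^n≢0 2 j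

%2^-periodic : ∀ j m q → (m + q * 2 ^ j) %2^ j ≡ m %2^ j
%2^-periodic j m q = [m+kn]%n≡m%n m q (2 ^ j)
  where instance _ = m^n≢0 2 j

%2^-small : ∀ {j m} → m < 2 ^ j → m %2^ j ≡ m
%2^-small {j} m<2^j = m<n⇒m%n≡m m<2^j
  where instance _ = m^n≢0 2 j

2^j+%2^j : ∀ {j m} → 2 ^ j ≤ m → m < 2 ^ suc j → 2 ^ j + m %2^ j ≡ m
2^j+%2^j {j} {m} 2^j≤m m<2^[1+j] = begin
  2 ^ j + m % 2 ^ j           ≡⟨ cong (2 ^ j +_) (m≤n⇒[n∸m]%m≡n%m 2^j≤m) ⟨
  2 ^ j + (m ∸ 2 ^ j) % 2 ^ j ≡⟨ cong (2 ^ j +_) (m<n⇒m%n≡m m∸2^j<2^j) ⟩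
  2 ^ j + (m ∸ 2 ^ j)         ≡⟨ m+[n∸m]≡n 2^j≤m ⟩
  m                           ∎
  where
  open ≡-Reasoning
  instance _ = m^n≢0 2 j
  m∸2^j<2^j : m ∸ 2 ^ j < 2 ^ j
  m∸2^j<2^j = subst (m ∸ 2 ^ j <_) (trans (m+n∸m≡n (2 ^ j) (2 ^ j + 0)) (+-identityʳ (2 ^ j)))
                (∸-monoˡ-< m<2^[1+j] 2^j≤m)

-- The U-MMB as a binary counter

increment : List Bool → List Bool
increment []           = false ∷ []
increment (false ∷ cs) = true ∷ cs
increment (true ∷ cs)  = false ∷ increment cs

-- A list of digits, least significant first, stands for the number with these digits below a
-- leading 1.
value : List Bool → ℕ
value []       = 1
value (c ∷ cs) = toℕ c + value cs * 2

value-increment : ∀ cs → value (increment cs) ≡ suc (value cs)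
value-increment []           = refl
value-increment (false ∷ cs) = refl
value-increment (true ∷ cs)  = cong (_* 2) (value-increment cs)

binary : ℕ → List Bool
binary zero    = []
binary (suc n) = increment (binary n)

value-binary : ∀ n → value (binary n) ≡ suc n
value-binary zero    = refl
value-binary (suc n) = trans (value-increment (binary n)) (cong suc (value-binary n))

value-bounds : ∀ cs → 2 ^ length cs ≤ value cs × value cs < 2 ^ suc (length cs)
value-bounds []       = ≤-refl , s≤s (s≤s z≤n)
value-bounds (c ∷ cs) = lower , upper
  where
  v = value cs
  lower : 2 * 2 ^ length cs ≤ toℕ c + v * 2
  lower = ≤-trans (≤-reflexive (*-comm 2 (2 ^ length cs)))
                  (≤-trans (*-monoˡ-≤ 2 (proj₁ (value-bounds cs))) (m≤n+m (v * 2) (toℕ c)))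
  upper : toℕ c + v * 2 < 2 * 2 ^ suc (length cs)
  upper = begin-strict
    toℕ c + v * 2           ≤⟨ +-monoˡ-≤ (v * 2) (toℕ≤1 c) ⟩
    suc (v * 2)             <⟨ *-monoˡ-≤ 2 (proj₂ (value-bounds cs)) ⟩
    2 ^ suc (length cs) * 2 ≡⟨ *-comm (2 ^ suc (length cs)) 2 ⟩
    2 * 2 ^ suc (length cs) ∎
    where open ≤-Reasoning

-- Mountain heights, right to left: a digit 1 at position i is a mountain of height i + 1, a digit 0
-- one of height i.
heightsOf : List Bool → List ℕ
heightsOf []       = []
heightsOf (c ∷ cs) = toℕ c ∷ map suc (heightsOf cs)

mergeRightmost-map-suc : ∀ hs → mergeRightmost (map suc hs) ≡ map suc (mergeRightmost hs)
mergeRightmost-map-suc []           = refl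
mergeRightmost-map-suc (x ∷ [])     = refl
mergeRightmost-map-suc (x ∷ y ∷ hs) =
  trans (cong (λ t → if x ≡ᵇ y then suc (suc x) ∷ map suc hs else suc x ∷ t)
              (mergeRightmost-map-suc (y ∷ hs)))
        (sym (if-float (map suc) (x ≡ᵇ y)))

mergeRightmost-heightsOf : ∀ cs → mergeRightmost (0 ∷ heightsOf cs) ≡ heightsOf (increment cs)
mergeRightmost-heightsOf []           = refl
mergeRightmost-heightsOf (false ∷ cs) = refl
mergeRightmost-heightsOf (true ∷ cs)  =
  cong (0 ∷_) (trans (mergeRightmost-map-suc (0 ∷ heightsOf cs)) (cong (map suc) (mergeRightmost-heightsOf cs)))

ummbRev≡heightsOf : ∀ n → ummbRev n ≡ heightsOf (binary n)
ummbRev≡heightsOf zero    = refl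
ummbRev≡heightsOf (suc n) =
  trans (cong (λ hs → mergeRightmost (0 ∷ hs)) (ummbRev≡heightsOf n)) (mergeRightmost-heightsOf (binary n))

applyUpTo-cong : ∀ {A : Set} {f g : ℕ → A} n → (∀ i → f i ≡ g i) → applyUpTo f n ≡ applyUpTo g n
applyUpTo-cong zero    f≗g = refl
applyUpTo-cong (suc n) f≗g = cong₂ _∷_ (f≗g 0) (applyUpTo-cong n (f≗g ∘ suc))

mountainHeight : ℕ → ℕ → ℕ
mountainHeight m i = i + bit i m

-- The lowest j mountains of the U-MMB whose number of leaves plus one is m, read left to right.
mountains : ℕ → ℕ → List ℕ
mountains m = applyDownFrom (mountainHeight m)

heightsOf-value : ∀ cs → heightsOf cs ≡ applyUpTo (mountainHeight (value cs)) (length cs)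
heightsOf-value []       = refl
heightsOf-value (c ∷ cs) = begin
  toℕ c ∷ map suc (heightsOf cs)
    ≡⟨ cong (λ hs → toℕ c ∷ map suc hs) (heightsOf-value cs) ⟩
  toℕ c ∷ map suc (applyUpTo (mountainHeight v) L)
    ≡⟨ cong (toℕ c ∷_) (map-applyUpTo (mountainHeight v) suc L) ⟩
  toℕ c ∷ applyUpTo (suc ∘ mountainHeight v) L
    ≡⟨ cong₂ _∷_ (sym (bit-zero-digit v c≤1)) (applyUpTo-cong L higher-bit) ⟩
  applyUpTo (mountainHeight (toℕ c + v * 2)) (suc L) ∎
  where
  open ≡-Reasoning
  v = value cs
  L = length cs
  c≤1 = toℕ≤1 c
  higher-bit : ∀ i → suc (mountainHeight v i) ≡ mountainHeight (toℕ c + v * 2) (suc i)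
  higher-bit i = cong (λ b → suc (i + b)) (sym (trans (bit-suc i _) (cong (bit i) (div2-digit v c≤1))))

mountainCount : ℕ → ℕ
mountainCount n = length (binary n)

ummb≡mountains : ∀ n → ummb n ≡ mountains (suc n) (mountainCount n)
ummb≡mountains n = begin
  reverse (ummbRev n)
    ≡⟨ cong reverse (ummbRev≡heightsOf n) ⟩
  reverse (heightsOf (binary n))
    ≡⟨ cong reverse (heightsOf-value (binary n)) ⟩
  reverse (applyUpTo (mountainHeight (value (binary n))) (mountainCount n))
    ≡⟨ reverse-applyUpTo _ (mountainCount n) ⟩
  mountains (value (binary n)) (mountainCount n)
    ≡⟨ cong (λ m → mountains m (mountainCount n)) (value-binary n) ⟩
  mountains (suc n) (mountainCount n) ∎
  where open ≡-Reasoning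

≤-mountainCount : ∀ {n e} → 2 ^ e ≤ suc n → e ≤ mountainCount n
≤-mountainCount {n} {e} 2^e≤1+n = ≮⇒≥ λ D<e →
  ≤⇒≯ (≤-trans (^-monoʳ-≤ 2 D<e) (≤-trans 2^e≤1+n (≤-reflexive (sym (value-binary n)))))
      (proj₂ (value-bounds (binary n)))

leafCount : List ℕ → ℕ
leafCount hs = sum (map (2 ^_) hs)

2^[j+c] : ∀ j {c} → c ≤ 1 → 2 ^ (j + c) ≡ 2 ^ j + c * 2 ^ j
2^[j+c] j z≤n       = trans (cong (2 ^_) (+-identityʳ j)) (sym (+-identityʳ (2 ^ j)))
2^[j+c] j (s≤s z≤n) = cong (2 ^_) (+-comm j 1)

suc-leafCount-mountains : ∀ m j → suc (leafCount (mountains m j)) ≡ 2 ^ j + m %2^ j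
suc-leafCount-mountains m zero    = cong suc (sym (n%1≡0 m))
suc-leafCount-mountains m (suc j) = begin
  suc (2 ^ (j + c) + leafCount (mountains m j))
    ≡⟨ +-suc (2 ^ (j + c)) _ ⟨
  2 ^ (j + c) + suc (leafCount (mountains m j))
    ≡⟨ cong₂ _+_ (2^[j+c] j (bit≤1 j m)) (suc-leafCount-mountains m j) ⟩
  (2 ^ j + c * 2 ^ j) + (2 ^ j + m %2^ j)
    ≡⟨ rearrange (2 ^ j) c (m %2^ j) ⟩
  2 * 2 ^ j + (m %2^ j + c * 2 ^ j)
    ≡⟨ cong (2 * 2 ^ j +_) (%2^-suc j m) ⟨
  2 ^ suc j + m %2^ suc j ∎
  where
  open ≡-Reasoning
  c = bit j m
  rearrange : ∀ x b r → (x + b * x) + (x + r) ≡ 2 * x + (r + b * x)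
  rearrange = solve-∀

leafCount-ummb : ∀ n → leafCount (ummb n) ≡ n
leafCount-ummb n = suc-injective (begin
  suc (leafCount (ummb n))              ≡⟨ cong (suc ∘ leafCount) (ummb≡mountains n) ⟩
  suc (leafCount (mountains (suc n) D)) ≡⟨ suc-leafCount-mountains (suc n) D ⟩
  2 ^ D + suc n %2^ D                   ≡⟨ 2^j+%2^j {D} lower upper ⟩
  suc n                                 ∎)
  where
  open ≡-Reasoning
  D = mountainCount n
  lower = subst (2 ^ D ≤_) (value-binary n) (proj₁ (value-bounds (binary n)))
  upper = subst (_< 2 ^ suc D) (value-binary n) (proj₂ (value-bounds (binary n)))

2^j≤1+leafCount : ∀ m j → 2 ^ j ≤ suc (leafCount (mountains m j))
2^j≤1+leafCount m j = subst (2 ^ j ≤_) (sym (suc-leafCount-mountains m j)) (m≤m+n (2 ^ j) (m %2^ j))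

1+leafCount<2^[1+j] : ∀ m j → suc (leafCount (mountains m j)) < 2 ^ suc j
1+leafCount<2^[1+j] m j = subst (_< 2 ^ suc j) (sym (suc-leafCount-mountains m j))
  (subst (2 ^ j + m %2^ j <_) (cong (2 ^ j +_) (sym (+-identityʳ (2 ^ j)))) (+-monoʳ-< (2 ^ j) (%2^-< j m)))

-- Belt counts through ranges

replicate-+ : ∀ {A : Set} m n (v : A) → replicate (m + n) v ≡ replicate m v ++ replicate n v
replicate-+ zero    n v = refl
replicate-+ (suc m) n v = cong (v ∷_) (replicate-+ m n v)

-- For mountains hs preceded by a mountain of height p, cuts p hs counts the range boundaries among
-- hs, and beltLabels p hs lists the belt ancestor counts of their leaves when hs are the rightmost
-- mountains.
cuts : Maybe ℕ → List ℕ → ℕ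
cuts p []          = 0
cuts p (x ∷ [])    = 0
cuts p (x ∷ y ∷ r) = toℕ (cut p x y) + cuts (just x) (y ∷ r)

beltLabels : Maybe ℕ → List ℕ → List ℕ
beltLabels p []      = []
beltLabels p (x ∷ r) = replicate (2 ^ x) (suc (cuts p (x ∷ r))) ++ beltLabels (just x) r

rangeLabels : List (List ℕ) → List ℕ
rangeLabels []       = []
rangeLabels (g ∷ gs) = replicate (leafCount g) (length (g ∷ gs)) ++ rangeLabels gs

NonEmpty : List ℕ → Set
NonEmpty g = 1 ≤ length g

length-addFront : ∀ c x gs → 1 ≤ length gs → length (addFront c x gs) ≡ toℕ c + length gs
length-addFront true  x gs       _ = refl
length-addFront false x (g ∷ gs) _ = refl

length-ranges′ : ∀ p x r → length (ranges′ p (x ∷ r)) ≡ suc (cuts p (x ∷ r))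
length-ranges′ p x []      = refl
length-ranges′ p x (y ∷ r) = begin
  length (addFront (cut p x y) x R)
    ≡⟨ length-addFront (cut p x y) x R (subst (1 ≤_) (sym (length-ranges′ (just x) y r)) (s≤s z≤n)) ⟩
  toℕ (cut p x y) + length R
    ≡⟨ cong (toℕ (cut p x y) +_) (length-ranges′ (just x) y r) ⟩
  toℕ (cut p x y) + suc (cuts (just x) (y ∷ r))
    ≡⟨ +-suc (toℕ (cut p x y)) _ ⟩
  suc (cuts p (x ∷ y ∷ r)) ∎
  where
  open ≡-Reasoning
  R = ranges′ (just x) (y ∷ r)

1≤length-ranges′ : ∀ p x r → 1 ≤ length (ranges′ p (x ∷ r))
1≤length-ranges′ p x r = subst (1 ≤_) (sym (length-ranges′ p x r)) (s≤s z≤n)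

rangeLabels-addFront : ∀ c x gs → 1 ≤ length gs →
                       rangeLabels (addFront c x gs) ≡ replicate (2 ^ x) (toℕ c + length gs) ++ rangeLabels gs
rangeLabels-addFront true  x gs       _ =
  cong (λ n → replicate n (suc (length gs)) ++ rangeLabels gs) (+-identityʳ (2 ^ x))
rangeLabels-addFront false x (g ∷ gs) _ = begin
  replicate (2 ^ x + leafCount g) L ++ rangeLabels gs
    ≡⟨ cong (_++ rangeLabels gs) (replicate-+ (2 ^ x) (leafCount g) L) ⟩
  (replicate (2 ^ x) L ++ replicate (leafCount g) L) ++ rangeLabels gs
    ≡⟨ ++-assoc (replicate (2 ^ x) L) _ _ ⟩
  replicate (2 ^ x) L ++ rangeLabels (g ∷ gs) ∎
  where
  open ≡-Reasoning
  L = length (g ∷ gs)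

rangeLabels-ranges′ : ∀ p xs → rangeLabels (ranges′ p xs) ≡ beltLabels p xs
rangeLabels-ranges′ p []          = refl
rangeLabels-ranges′ p (x ∷ [])    = cong (λ n → replicate n 1 ++ []) (+-identityʳ (2 ^ x))
rangeLabels-ranges′ p (x ∷ y ∷ r) = begin
  rangeLabels (addFront (cut p x y) x R)
    ≡⟨ rangeLabels-addFront (cut p x y) x R (1≤length-ranges′ (just x) y r) ⟩
  replicate (2 ^ x) (toℕ (cut p x y) + length R) ++ rangeLabels R
    ≡⟨ cong₂ (λ n ls → replicate (2 ^ x) n ++ ls) label (rangeLabels-ranges′ (just x) (y ∷ r)) ⟩
  beltLabels p (x ∷ y ∷ r) ∎
  where
  open ≡-Reasoning
  R = ranges′ (just x) (y ∷ r)
  label : toℕ (cut p x y) + length R ≡ suc (cuts p (x ∷ y ∷ r))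
  label = trans (cong (toℕ (cut p x y) +_) (length-ranges′ (just x) y r)) (+-suc (toℕ (cut p x y)) _)

All-addFront : ∀ c x {gs} → All NonEmpty gs → All NonEmpty (addFront c x gs)
All-addFront true  x ne       = s≤s z≤n ∷ ne
All-addFront false x []       = s≤s z≤n ∷ []
All-addFront false x (_ ∷ ne) = s≤s z≤n ∷ ne

ranges′-nonEmpty : ∀ p xs → All NonEmpty (ranges′ p xs)
ranges′-nonEmpty p []          = []
ranges′-nonEmpty p (x ∷ [])    = s≤s z≤n ∷ []
ranges′-nonEmpty p (x ∷ y ∷ r) = All-addFront (cut p x y) x (ranges′-nonEmpty (just x) (y ∷ r))

beltCounts-mountain : ∀ s → beltCounts (mountain s) ≡ replicate (2 ^ s) 0
beltCounts-mountain zero    = refl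
beltCounts-mountain (suc s) = begin
  beltCounts (mountain s) ++ beltCounts (mountain s)
    ≡⟨ cong₂ _++_ (beltCounts-mountain s) (beltCounts-mountain s) ⟩
  replicate (2 ^ s) 0 ++ replicate (2 ^ s) 0
    ≡⟨ replicate-+ (2 ^ s) (2 ^ s) 0 ⟨
  replicate (2 ^ s + 2 ^ s) 0
    ≡⟨ cong (λ n → replicate (2 ^ s + n) 0) (+-identityʳ (2 ^ s)) ⟨
  replicate (2 ^ suc s) 0 ∎
  where open ≡-Reasoning

beltCounts-rangeChain : ∀ acc hs → beltCounts (chainFrom rnode1 rnode2 acc (map mountain hs))
                                    ≡ beltCounts acc ++ replicate (leafCount hs) 0
beltCounts-rangeChain acc []       = sym (++-identityʳ (beltCounts acc))
beltCounts-rangeChain acc (h ∷ hs) = begin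
  beltCounts (chainFrom rnode1 rnode2 (rnode2 acc (mountain h)) (map mountain hs))
    ≡⟨ beltCounts-rangeChain (rnode2 acc (mountain h)) hs ⟩
  (beltCounts acc ++ beltCounts (mountain h)) ++ replicate (leafCount hs) 0
    ≡⟨ ++-assoc (beltCounts acc) _ _ ⟩
  beltCounts acc ++ (beltCounts (mountain h) ++ replicate (leafCount hs) 0)
    ≡⟨ cong (λ ls → beltCounts acc ++ (ls ++ replicate (leafCount hs) 0)) (beltCounts-mountain h) ⟩
  beltCounts acc ++ (replicate (2 ^ h) 0 ++ replicate (leafCount hs) 0)
    ≡⟨ cong (beltCounts acc ++_) (replicate-+ (2 ^ h) (leafCount hs) 0) ⟨
  beltCounts acc ++ replicate (leafCount (h ∷ hs)) 0 ∎
  where open ≡-Reasoning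

beltCounts-rangeRoot : ∀ g → beltCountsM (rangeRoot g) ≡ replicate (leafCount g) 0
beltCounts-rangeRoot []       = refl
beltCounts-rangeRoot (h ∷ hs) = begin
  beltCounts (chainFrom rnode1 rnode2 (rnode1 (mountain h)) (map mountain hs))
    ≡⟨ beltCounts-rangeChain (rnode1 (mountain h)) hs ⟩
  beltCounts (mountain h) ++ replicate (leafCount hs) 0
    ≡⟨ cong (_++ replicate (leafCount hs) 0) (beltCounts-mountain h) ⟩
  replicate (2 ^ h) 0 ++ replicate (leafCount hs) 0
    ≡⟨ replicate-+ (2 ^ h) (leafCount hs) 0 ⟨
  replicate (leafCount (h ∷ hs)) 0 ∎
  where open ≡-Reasoning

map-+-suc : ∀ L xs → map (_+ L) (map suc xs) ≡ map (_+ suc L) xs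
map-+-suc L xs = trans (sym (map-∘ xs)) (map-cong (λ x → sym (+-suc x L)) xs)

raised-rangeRoot : ∀ L g → map (_+ L) (map suc (beltCountsM (rangeRoot g))) ≡ replicate (leafCount g) (suc L)
raised-rangeRoot L g = begin
  map (_+ L) (map suc (beltCountsM (rangeRoot g))) ≡⟨ map-+-suc L _ ⟩
  map (_+ suc L) (beltCountsM (rangeRoot g))       ≡⟨ cong (map (_+ suc L)) (beltCounts-rangeRoot g) ⟩
  map (_+ suc L) (replicate (leafCount g) 0)       ≡⟨ map-replicate (_+ suc L) (leafCount g) 0 ⟩
  replicate (leafCount g) (suc L)                  ∎
  where open ≡-Reasoning

beltCounts-beltChain : ∀ acc gs → All NonEmpty gs →
  beltCounts (chainFrom bnode1 bnode2 acc (catMaybes (map rangeRoot gs)))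
    ≡ map (_+ length gs) (beltCounts acc) ++ rangeLabels gs
beltCounts-beltChain acc [] [] =
  sym (trans (++-identityʳ _) (trans (map-cong +-identityʳ (beltCounts acc)) (map-id (beltCounts acc))))
beltCounts-beltChain acc (g@(h ∷ hs) ∷ gs) (_ ∷ ne) = begin
  beltCounts (chainFrom bnode1 bnode2 (bnode2 acc t) (catMaybes (map rangeRoot gs)))
    ≡⟨ beltCounts-beltChain (bnode2 acc t) gs ne ⟩
  map (_+ L) (map suc (ℓ ++ beltCounts t)) ++ rangeLabels gs
    ≡⟨ cong (λ ls → map (_+ L) ls ++ rangeLabels gs) (map-++ suc ℓ (beltCounts t)) ⟩
  map (_+ L) (map suc ℓ ++ map suc (beltCounts t)) ++ rangeLabels gs
    ≡⟨ cong (_++ rangeLabels gs) (map-++ (_+ L) (map suc ℓ) _) ⟩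
  (map (_+ L) (map suc ℓ) ++ map (_+ L) (map suc (beltCounts t))) ++ rangeLabels gs
    ≡⟨ ++-assoc (map (_+ L) (map suc ℓ)) _ _ ⟩
  map (_+ L) (map suc ℓ) ++ (map (_+ L) (map suc (beltCounts t)) ++ rangeLabels gs)
    ≡⟨ cong₂ (λ ls ms → ls ++ (ms ++ rangeLabels gs)) (map-+-suc L ℓ) (raised-rangeRoot L g) ⟩
  map (_+ suc L) ℓ ++ rangeLabels (g ∷ gs) ∎
  where
  open ≡-Reasoning
  L = length gs
  ℓ = beltCounts acc
  t = chainFrom rnode1 rnode2 (rnode1 (mountain h)) (map mountain hs)
beltCounts-mmb : ∀ n → beltCountsM (mmb n) ≡ beltLabels nothing (ummb n)
beltCounts-mmb n =
  trans (belt (ranges (ummb n)) (ranges′-nonEmpty nothing (ummb n))) (rangeLabels-ranges′ nothing (ummb n))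
  where
  belt : ∀ gs → All NonEmpty gs →
         beltCountsM (chain bnode1 bnode2 (catMaybes (map rangeRoot gs))) ≡ rangeLabels gs
  belt []                  []       = refl
  belt (g@(h ∷ hs) ∷ gs)   (_ ∷ ne) =
    trans (beltCounts-beltChain (bnode1 (chainFrom rnode1 rnode2 (rnode1 (mountain h)) (map mountain hs))) gs ne)
          (cong (_++ rangeLabels gs) (raised-rangeRoot (length gs) g))

nth-replicate-++ : ∀ {a i} v xs → i < a → nth (replicate a v ++ xs) i ≡ v
nth-replicate-++ {suc a} {zero}  v xs _         = refl
nth-replicate-++ {suc a} {suc i} v xs (s≤s i<a) = nth-replicate-++ v xs i<a

nth-replicate-++-+ : ∀ a v xs i → nth (replicate a v ++ xs) (a + i) ≡ nth xs i
nth-replicate-++-+ zero    v xs i = refl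
nth-replicate-++-+ (suc a) v xs i = nth-replicate-++-+ a v xs i

nth-beltLabels-here : ∀ p x r {k} → leafCount r < k → k ≤ leafCount (x ∷ r) →
                      nth (beltLabels p (x ∷ r)) (leafCount (x ∷ r) ∸ k) ≡ suc (cuts p (x ∷ r))
nth-beltLabels-here p x r {k} lc<k k≤lc = nth-replicate-++ _ _
  (subst (2 ^ x + leafCount r ∸ k <_) (m+n∸n≡m (2 ^ x) k) (∸-monoˡ-< (+-monoʳ-< (2 ^ x) lc<k) k≤lc))

nth-beltLabels-there : ∀ p x r {k} → k ≤ leafCount r →
                       nth (beltLabels p (x ∷ r)) (leafCount (x ∷ r) ∸ k)
                         ≡ nth (beltLabels (just x) r) (leafCount r ∸ k)
nth-beltLabels-there p x r {k} k≤lc =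
  trans (cong (nth (beltLabels p (x ∷ r))) (+-∸-assoc (2 ^ x) k≤lc)) (nth-replicate-++-+ (2 ^ x) _ _ _)

-- Range boundaries between the lowest mountains

-- Whether mountains of heights i + 1 + c₁ and i + c₀, preceded by one of height i + 2 + c₂, lie in
-- different ranges.
boundary : ℕ → ℕ → ℕ → ℕ
boundary c₀      zero    c₂      = 0
boundary c₀      (suc _) zero    = 1
boundary zero    (suc _) (suc _) = 1
boundary (suc _) (suc _) (suc _) = 0

cut-heights : ∀ i {c₀ c₁ c₂} → c₀ ≤ 1 → c₁ ≤ 1 → c₂ ≤ 1 →
              toℕ (cut (just (2 + i + c₂)) (1 + i + c₁) (i + c₀)) ≡ boundary c₀ c₁ c₂
cut-heights (suc i) c₀≤1 c₁≤1 c₂≤1 = cut-heights i c₀≤1 c₁≤1 c₂≤1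
cut-heights zero z≤n       z≤n       z≤n       = refl
cut-heights zero z≤n       z≤n       (s≤s z≤n) = refl
cut-heights zero z≤n       (s≤s z≤n) z≤n       = refl
cut-heights zero z≤n       (s≤s z≤n) (s≤s z≤n) = refl
cut-heights zero (s≤s z≤n) z≤n       z≤n       = refl
cut-heights zero (s≤s z≤n) z≤n       (s≤s z≤n) = refl
cut-heights zero (s≤s z≤n) (s≤s z≤n) z≤n       = refl
cut-heights zero (s≤s z≤n) (s≤s z≤n) (s≤s z≤n) = refl

boundaryAt : ℕ → ℕ → ℕ
boundaryAt m i = boundary (bit i m) (bit (suc i) m) (bit (suc (suc i)) m)

cuts-mountains : ∀ m j →
                 cuts (just (mountainHeight m (suc j))) (mountains m (suc j)) ≡ ∑[ i < j ] boundaryAt m i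
cuts-mountains m zero    = refl
cuts-mountains m (suc j) =
  cong₂ _+_ (cut-heights j (bit≤1 j m) (bit≤1 (suc j) m) (bit≤1 (suc (suc j)) m)) (cuts-mountains m j)

boundary≤1 : ∀ c₀ c₁ c₂ → boundary c₀ c₁ c₂ ≤ 1
boundary≤1 c₀      zero    c₂      = z≤n
boundary≤1 c₀      (suc _) zero    = ≤-refl
boundary≤1 zero    (suc _) (suc _) = ≤-refl
boundary≤1 (suc _) (suc _) (suc _) = z≤n

boundaryAt-periodic : ∀ {i L} m q → suc (suc i) < L → boundaryAt (m + q * 2 ^ L) i ≡ boundaryAt m i
boundaryAt-periodic {i} {L} m q 2+i<L =
  trans (cong₂ (λ c₀ c₁ → boundary c₀ c₁ (bit (2 + i) (m + q * 2 ^ L)))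
               (bit-periodic m q (<-trans (n<1+n i) 1+i<L)) (bit-periodic m q 1+i<L))
        (cong (boundary (bit i m) (bit (suc i) m)) (bit-periodic m q 2+i<L))
  where
  1+i<L : suc i < L
  1+i<L = <-trans (n<1+n (suc i)) 2+i<L

boundaryAt-high : ∀ i {x} y → x < 2 ^ i → boundaryAt (x + y * 2 ^ i) i ≡ boundaryAt y 0
boundaryAt-high i {x} y x<2^i =
  trans (cong₂ (λ c₀ c₁ → boundary c₀ c₁ (bit (2 + i) (x + y * 2 ^ i)))
               (bit-high i 0 y x<2^i) (bit-high i 1 y x<2^i))
        (cong (boundary (bit 0 y) (bit 1 y)) (bit-high i 2 y x<2^i))

-- Among the eight patterns of three consecutive digits, exactly three make a boundary.
∑-boundaryAt : ∀ i L → 3 + i ≤ L → ∑[ m < 2 ^ L ] boundaryAt m i ≡ 3 * 2 ^ (L ∸ 3)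
∑-boundaryAt i L 3+i≤L = begin
  ∑[ m < 2 ^ L ] boundaryAt m i
    ≡⟨ cong (λ n → ∑[ m < n ] boundaryAt m i) 2^L≡2^e*2^[3+i] ⟩
  ∑[ m < 2 ^ e * 2 ^ (3 + i) ] boundaryAt (0 + m) i
    ≡⟨ ∑-periodic periodic 0 (2 ^ e) ⟩
  2 ^ e * ∑[ m < 2 ^ (3 + i) ] boundaryAt m i
    ≡⟨ cong (λ n → 2 ^ e * ∑[ m < n ] boundaryAt m i) (2^[3+n] (2 ^ i)) ⟩
  2 ^ e * ∑[ m < 8 * 2 ^ i ] boundaryAt m i
    ≡⟨ cong (2 ^ e *_) (∑-blocks 8 (2 ^ i) (λ m → boundaryAt m i)) ⟩
  2 ^ e * ∑[ y < 8 ] ∑[ x < 2 ^ i ] boundaryAt (x + y * 2 ^ i) i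
    ≡⟨ cong (2 ^ e *_) (∑-cong 8 (λ y _ → ∑-cong (2 ^ i) (λ x x<2^i → boundaryAt-high i y x<2^i))) ⟩
  2 ^ e * ∑[ y < 8 ] ∑[ x < 2 ^ i ] boundaryAt y 0
    ≡⟨ cong (2 ^ e *_) (∑-swap 8 (2 ^ i) (λ y _ → boundaryAt y 0)) ⟩
  2 ^ e * ∑[ x < 2 ^ i ] 3
    ≡⟨ cong (2 ^ e *_) (∑-const (2 ^ i) 3) ⟩
  2 ^ e * (2 ^ i * 3)
    ≡⟨ *-comm-3 (2 ^ e) (2 ^ i) ⟩
  3 * (2 ^ e * 2 ^ i)
    ≡⟨ cong (3 *_) (^-distribˡ-+-* 2 e i) ⟨
  3 * 2 ^ (e + i)
    ≡⟨ cong (λ n → 3 * 2 ^ n) L∸3≡e+i ⟨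
  3 * 2 ^ (L ∸ 3) ∎
  where
  open ≡-Reasoning
  e = L ∸ (3 + i)
  L≡e+[3+i] : L ≡ e + (3 + i)
  L≡e+[3+i] = sym (m∸n+n≡m 3+i≤L)
  2^L≡2^e*2^[3+i] : 2 ^ L ≡ 2 ^ e * 2 ^ (3 + i)
  2^L≡2^e*2^[3+i] = trans (cong (2 ^_) L≡e+[3+i]) (^-distribˡ-+-* 2 e (3 + i))
  L∸3≡e+i : L ∸ 3 ≡ e + i
  L∸3≡e+i = trans (cong (_∸ 3) (trans L≡e+[3+i] (m+[n+o]≡n+[m+o] e 3 i))) (m+n∸m≡n 3 (e + i))
  2^[3+n] : ∀ x → 2 * (2 * (2 * x)) ≡ 8 * x
  2^[3+n] = solve-∀
  *-comm-3 : ∀ x y → x * (y * 3) ≡ 3 * (x * y)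
  *-comm-3 = solve-∀
  periodic : Periodic (2 ^ (3 + i)) (λ m → boundaryAt m i)
  periodic m = trans (cong (λ z → boundaryAt (m + z) i) (sym (*-identityˡ (2 ^ (3 + i)))))
                     (boundaryAt-periodic {i} m 1 ≤-refl)

-- The k-th newest leaf

module NewestLeaf (k d′ : ℕ) (2^d≤k+1 : 2 ^ suc d′ ≤ k + 1) (k+1<2^[d+1] : k + 1 < 2 ^ (suc d′ + 1))
  where

  d T X P : ℕ
  d = suc d′
  T = 2 ^ d′
  X = 2 ^ d
  P = 2 ^ suc (suc d)

  P≡4*X : P ≡ 4 * X
  P≡4*X = 2*[2*x]≡4*x X
    where
    2*[2*x]≡4*x : ∀ x → 2 * (2 * x) ≡ 4 * x
    2*[2*x]≡4*x = solve-∀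

  X≤1+k : X ≤ suc k
  X≤1+k = subst (X ≤_) (+-comm k 1) 2^d≤k+1

  2+k≤2^[1+d] : suc (suc k) ≤ 2 ^ suc d
  2+k≤2^[1+d] = subst₂ (λ a e → suc a ≤ 2 ^ e) (+-comm k 1) (+-comm d 1) k+1<2^[d+1]

  kthNewestLabel : Maybe ℕ → List ℕ → ℕ
  kthNewestLabel p hs = nth (beltLabels p hs) (leafCount hs ∸ k)

  farBoundaries : ℕ → ℕ
  farBoundaries m = ∑[ i < d′ ] boundaryAt m i

  nearBoundary : ℕ → ℕ
  nearBoundary m = toℕ (X + m %2^ d <ᵇ suc k) * boundaryAt m d′

  -- For m = n + 1 ≥ 2^(d+2) the k-th newest leaf lies in mountain d - 1 or d (counting from 0 at the
  -- right), in mountain d exactly when the lower d mountains, which hold 2^d + m mod 2^d - 1 leaves,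
  -- hold fewer than k; its belt count is one plus the number of boundaries right of its mountain.
  leafLabel : ℕ → ℕ
  leafLabel m = suc (farBoundaries m + nearBoundary m)

  kthNewestLabel-tail : ∀ m j p → suc d ≤ j →
                        kthNewestLabel p (mountains m (suc j)) ≡ kthNewestLabel (just (mountainHeight m j)) (mountains m j)
  kthNewestLabel-tail m j p 1+d≤j = nth-beltLabels-there p (mountainHeight m j) (mountains m j) k≤leafCount
    where
    k≤leafCount : k ≤ leafCount (mountains m j)
    k≤leafCount =
      <⇒≤ (≤-pred (≤-trans 2+k≤2^[1+d] (≤-trans (^-monoʳ-≤ 2 1+d≤j) (2^j≤1+leafCount m j))))

  kthNewestLabel-lowest : ∀ m t p → kthNewestLabel p (mountains m (t + suc (suc d)))
                                    ≡ kthNewestLabel (just (mountainHeight m (suc d))) (mountains m (suc d))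
  kthNewestLabel-lowest m zero    p = kthNewestLabel-tail m (suc d) p ≤-refl
  kthNewestLabel-lowest m (suc t) p =
    trans (kthNewestLabel-tail m (t + suc (suc d)) p (≤-trans (n≤1+n (suc d)) (m≤n+m _ t)))
          (kthNewestLabel-lowest m t _)

  kthNewestLabel≡leafLabel : ∀ m →
                             kthNewestLabel (just (mountainHeight m (suc d))) (mountains m (suc d)) ≡ leafLabel m
  kthNewestLabel≡leafLabel m with X + m %2^ d <? suc k
  ... | yes in-d = begin
    kthNewestLabel (just (mountainHeight m (suc d))) (mountains m (suc d))
      ≡⟨ nth-beltLabels-here (just (mountainHeight m (suc d))) (mountainHeight m d) (mountains m d) lc<k k≤lc ⟩
    suc (cuts (just (mountainHeight m (suc d))) (mountains m (suc d)))
      ≡⟨ cong suc (cuts-mountains m d) ⟩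
    suc (boundaryAt m d′ + farBoundaries m)
      ≡⟨ cong suc (trans (+-comm (boundaryAt m d′) (farBoundaries m))
                         (cong (farBoundaries m +_) (sym (*-identityˡ (boundaryAt m d′))))) ⟩
    suc (farBoundaries m + 1 * boundaryAt m d′)
      ≡⟨ cong (λ c → suc (farBoundaries m + c * boundaryAt m d′)) (toℕ-<ᵇ-yes in-d) ⟨
    leafLabel m ∎
    where
    open ≡-Reasoning
    lc<k : leafCount (mountains m d) < k
    lc<k = ≤-pred (subst (_< suc k) (sym (suc-leafCount-mountains m d)) in-d)
    k≤lc : k ≤ leafCount (mountains m (suc d))
    k≤lc = <⇒≤ (≤-pred (≤-trans 2+k≤2^[1+d] (2^j≤1+leafCount m (suc d))))
  ... | no ¬in-d = begin
    kthNewestLabel (just (mountainHeight m (suc d))) (mountains m (suc d))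
      ≡⟨ nth-beltLabels-there (just (mountainHeight m (suc d))) (mountainHeight m d) (mountains m d) k≤lc ⟩
    kthNewestLabel (just (mountainHeight m d)) (mountains m d)
      ≡⟨ nth-beltLabels-here (just (mountainHeight m d)) (mountainHeight m d′) (mountains m d′) lc′<k k≤lc ⟩
    suc (cuts (just (mountainHeight m d)) (mountains m d))
      ≡⟨ cong suc (trans (cuts-mountains m d′) (sym (+-identityʳ (farBoundaries m)))) ⟩
    suc (farBoundaries m + 0 * boundaryAt m d′)
      ≡⟨ cong (λ c → suc (farBoundaries m + c * boundaryAt m d′)) (toℕ-<ᵇ-no ¬in-d) ⟨
    leafLabel m ∎
    where
    open ≡-Reasoning
    k≤lc : k ≤ leafCount (mountains m d)
    k≤lc = ≤-pred (subst (suc k ≤_) (sym (suc-leafCount-mountains m d)) (≮⇒≥ ¬in-d))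
    lc′<k : leafCount (mountains m d′) < k
    lc′<k = ≤-pred (≤-trans (1+leafCount<2^[1+j] m d′) X≤1+k)
  b≡leafLabel : ∀ n → P ≤ suc n → b k n ≡ leafLabel (suc n)
  b≡leafLabel n P≤1+n = begin
    nth (beltCountsM (mmb n)) (n ∸ k)
      ≡⟨ cong₂ (λ ls z → nth ls (z ∸ k)) (beltCounts-mmb n) (sym (leafCount-ummb n)) ⟩
    kthNewestLabel nothing (ummb n)
      ≡⟨ cong (kthNewestLabel nothing) (ummb≡mountains n) ⟩
    kthNewestLabel nothing (mountains (suc n) (mountainCount n))
      ≡⟨ cong (kthNewestLabel nothing ∘ mountains (suc n)) count≡t+[2+d] ⟩
    kthNewestLabel nothing (mountains (suc n) (t + suc (suc d)))
      ≡⟨ kthNewestLabel-lowest (suc n) t nothing ⟩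
    kthNewestLabel (just (mountainHeight (suc n) (suc d))) (mountains (suc n) (suc d))
      ≡⟨ kthNewestLabel≡leafLabel (suc n) ⟩
    leafLabel (suc n) ∎
    where
    open ≡-Reasoning
    t = mountainCount n ∸ suc (suc d)
    count≡t+[2+d] : mountainCount n ≡ t + suc (suc d)
    count≡t+[2+d] = sym (m∸n+n≡m (≤-mountainCount P≤1+n))

  leafLabel-periodic : Periodic P leafLabel
  leafLabel-periodic m =
    cong suc (cong₂ _+_ (∑-cong d′ (λ i i<d′ → same-boundary (m≤n⇒m≤1+n i<d′)))
                        (cong₂ _*_ (cong (λ r → toℕ (X + r <ᵇ suc k)) same-low) (same-boundary ≤-refl)))
    where
    m+P≡m+1*P : m + P ≡ m + 1 * P
    m+P≡m+1*P = cong (m +_) (sym (*-identityˡ P))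
    same-boundary : ∀ {i} → i < d → boundaryAt (m + P) i ≡ boundaryAt m i
    same-boundary {i} i<d =
      trans (cong (λ z → boundaryAt z i) m+P≡m+1*P) (boundaryAt-periodic m 1 (s≤s (s≤s i<d)))
    same-low : (m + P) %2^ d ≡ m %2^ d
    same-low = trans (cong (λ z → (m + z) %2^ d) P≡4*X) (%2^-periodic d m 4)

  leafLabel-≤ : ∀ m → leafLabel m ≤ 2 + d′
  leafLabel-≤ m = s≤s (≤-trans (+-mono-≤ far near) (≤-reflexive (+-comm d′ 1)))
    where
    far : farBoundaries m ≤ d′
    far = ≤-trans (∑-≤ d′ (λ i → boundary≤1 (bit i m) (bit (suc i) m) (bit (suc (suc i)) m)))
                  (≤-reflexive (*-identityʳ d′))
    near : nearBoundary m ≤ 1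
    near = *-mono-≤ (toℕ≤1 (X + m %2^ d <ᵇ suc k)) (boundary≤1 (bit d′ m) (bit d m) (bit (suc d) m))

  ∑-farBoundaries : ∑ P farBoundaries ≡ d′ * (3 * T)
  ∑-farBoundaries = begin
    ∑[ m < P ] ∑[ i < d′ ] boundaryAt m i
      ≡⟨ ∑-swap P d′ (λ m i → boundaryAt m i) ⟩
    ∑[ i < d′ ] ∑[ m < P ] boundaryAt m i
      ≡⟨ ∑-cong d′ (λ i i<d′ → ∑-boundaryAt i (suc (suc d)) (s≤s (s≤s (s≤s (<⇒≤ i<d′))))) ⟩
    ∑[ i < d′ ] (3 * T)
      ≡⟨ ∑-const d′ (3 * T) ⟩
    d′ * (3 * T) ∎
    where open ≡-Reasoning

  countBelow : ℕ → ℕ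
  countBelow c = ∑[ x < T ] toℕ (c + x <ᵇ suc k)

  nearBoundary-block : ∀ j {x} → x < X →
                       nearBoundary (x + j * X) ≡ toℕ (X + x <ᵇ suc k) * boundary (bit d′ x) (bit 0 j) (bit 1 j)
  nearBoundary-block j {x} x<X = cong₂ _*_
    (cong (λ r → toℕ (X + r <ᵇ suc k)) (trans (%2^-periodic d x j) (%2^-small {d} x<X)))
    (trans (cong₂ (λ c₀ c₁ → boundary c₀ c₁ (bit (suc d) (x + j * X)))
                  (bit-periodic {d′} {d} x j ≤-refl) (bit-high d 0 j x<X))
           (cong (boundary (bit d′ x) (bit 0 j)) (bit-high d 1 j x<X)))

  ∑-halves : ∀ (g : ℕ → ℕ) → ∑ X g ≡ ∑ T g + ∑[ x < T ] g (T + x)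
  ∑-halves g = trans (cong (λ n → ∑ n g) (cong (T +_) (+-identityʳ T))) (∑-split T T g)

  -- In the blocks j = 0, 1, 2, 3 of 2^d consecutive m the digits d, d + 1 of m are those of j, so
  -- the near boundary only occurs in blocks 1 and 3, in block 3 only when digit d - 1 is 0.
  ∑-nearBoundary : ∑[ m < P ] nearBoundary m ≡ countBelow X + countBelow X + countBelow (X + T)
  ∑-nearBoundary = begin
    ∑[ m < P ] nearBoundary m
      ≡⟨ cong (λ n → ∑ n nearBoundary) P≡4*X ⟩
    ∑[ m < 4 * X ] nearBoundary m
      ≡⟨ ∑-blocks 4 X nearBoundary ⟩
    ∑[ j < 4 ] ∑[ x < X ] nearBoundary (x + j * X)
      ≡⟨ ∑-cong 4 (λ j _ → ∑-cong X (λ x x<X → nearBoundary-block j x<X)) ⟩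
    ∑[ j < 4 ] ∑[ x < X ] (F x * boundary (bit d′ x) (bit 0 j) (bit 1 j))
      ≡⟨ cong₂ _+_ block₃ (cong₂ _+_ (∑-*-zero X F) (cong₂ _+_ block₁ (cong (_+ 0) (∑-*-zero X F)))) ⟩
    countBelow X + (0 + ((countBelow X + countBelow (X + T)) + (0 + 0)))
      ≡⟨ rearrange (countBelow X) (countBelow (X + T)) ⟩
    countBelow X + countBelow X + countBelow (X + T) ∎
    where
    open ≡-Reasoning
    F : ℕ → ℕ
    F x = toℕ (X + x <ᵇ suc k)
    rearrange : ∀ u v → u + (0 + ((u + v) + (0 + 0))) ≡ u + u + v
    rearrange = solve-∀
    block₁ : ∑[ x < X ] (F x * 1) ≡ countBelow X + countBelow (X + T)
    block₁ = begin
      ∑[ x < X ] (F x * 1)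
        ≡⟨ ∑-cong X (λ x _ → *-identityʳ (F x)) ⟩
      ∑ X F
        ≡⟨ ∑-halves F ⟩
      ∑ T F + ∑[ x < T ] F (T + x)
        ≡⟨ cong (countBelow X +_) (∑-cong T (λ x _ → cong (λ z → toℕ (z <ᵇ suc k)) (sym (+-assoc X T x)))) ⟩
      countBelow X + countBelow (X + T) ∎
    block₃ : ∑[ x < X ] (F x * boundary (bit d′ x) 1 1) ≡ countBelow X
    block₃ = begin
      ∑[ x < X ] (F x * boundary (bit d′ x) 1 1)
        ≡⟨ ∑-halves (λ x → F x * boundary (bit d′ x) 1 1) ⟩
      ∑[ x < T ] (F x * boundary (bit d′ x) 1 1) + ∑[ x < T ] (F (T + x) * boundary (bit d′ (T + x)) 1 1)
        ≡⟨ cong₂ _+_ (∑-cong T (λ x x<T → cong (λ c → F x * boundary c 1 1) (bit-below {d′} x<T)))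
                     (∑-cong T (λ x x<T → cong (λ c → F (T + x) * boundary c 1 1) (bit-above {d′} x<T))) ⟩
      ∑[ x < T ] (F x * 1) + ∑[ x < T ] (F (T + x) * 0)
        ≡⟨ cong₂ _+_ (∑-cong T (λ x _ → *-identityʳ (F x))) (∑-*-zero T (λ x → F (T + x))) ⟩
      countBelow X + 0
        ≡⟨ +-identityʳ (countBelow X) ⟩
      countBelow X ∎

  ∑-leafLabel : ∑ P leafLabel ≡ P + (d′ * (3 * T) + (countBelow X + countBelow X + countBelow (X + T)))
  ∑-leafLabel = begin
    ∑[ m < P ] leafLabel m
      ≡⟨ ∑-suc P (λ m → farBoundaries m + nearBoundary m) ⟩
    P + ∑[ m < P ] (farBoundaries m + nearBoundary m)
      ≡⟨ cong (P +_) (∑-+ P farBoundaries nearBoundary) ⟩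
    P + (∑ P farBoundaries + ∑ P nearBoundary)
      ≡⟨ cong (P +_) (cong₂ _+_ ∑-farBoundaries ∑-nearBoundary) ⟩
    P + (d′ * (3 * T) + (countBelow X + countBelow X + countBelow (X + T))) ∎
    where open ≡-Reasoning

  ∑-leafLabel-≤ : 2 * (k + 1) ≤ 3 * X → ∑[ m < P ] leafLabel m ≡ 3 * d * T + 2 * (k + 1) + T
  ∑-leafLabel-≤ 2[k+1]≤3X = begin
    ∑[ m < P ] leafLabel m
      ≡⟨ ∑-leafLabel ⟩
    P + (d′ * (3 * T) + (countBelow X + countBelow X + countBelow (X + T)))
      ≡⟨ cong (λ z → P + (d′ * (3 * T) + z)) (cong₂ _+_ (cong₂ _+_ below-X below-X) below-X+T) ⟩
    P + (d′ * (3 * T) + (u + u + 0))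
      ≡⟨ rearrange T d′ u ⟩
    3 * d * T + 2 * (X + u) + T
      ≡⟨ cong (λ z → 3 * d * T + 2 * z + T) k+1≡X+u ⟨
    3 * d * T + 2 * (k + 1) + T ∎
    where
    open ≡-Reasoning
    u = suc k ∸ X
    k+1≡X+u : k + 1 ≡ X + u
    k+1≡X+u = trans (+-comm k 1) (sym (m+[n∸m]≡n X≤1+k))
    1+k≤X+T : suc k ≤ X + T
    1+k≤X+T = *-cancelˡ-≤ 2 (subst₂ _≤_ (cong (2 *_) (+-comm k 1)) (3*[2*t]≡2*[2*t+t] T) 2[k+1]≤3X)
      where
      3*[2*t]≡2*[2*t+t] : ∀ t → 3 * (2 * t) ≡ 2 * (2 * t + t)
      3*[2*t]≡2*[2*t+t] = solve-∀
    below-X : countBelow X ≡ u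
    below-X = trans (∑-count-< X T (suc k)) (m≤n⇒m⊓n≡m (m≤n+o⇒m∸n≤o (suc k) X 1+k≤X+T))
    below-X+T : countBelow (X + T) ≡ 0
    below-X+T = trans (∑-count-< (X + T) T (suc k)) (cong (_⊓ T) (m≤n⇒m∸n≡0 1+k≤X+T))
    rearrange : ∀ t d′ u → 2 * (2 * (2 * t)) + (d′ * (3 * t) + (u + u + 0))
                           ≡ 3 * (1 + d′) * t + 2 * (2 * t + u) + t
    rearrange = solve-∀

  ∑-leafLabel-> : 3 * X < 2 * (k + 1) → ∑[ m < P ] leafLabel m ≡ 3 * d * T + (k + 1) + 4 * T
  ∑-leafLabel-> 3X<2[k+1] = begin
    ∑[ m < P ] leafLabel m
      ≡⟨ ∑-leafLabel ⟩
    P + (d′ * (3 * T) + (countBelow X + countBelow X + countBelow (X + T)))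
      ≡⟨ cong (λ z → P + (d′ * (3 * T) + z)) (cong₂ _+_ (cong₂ _+_ below-X below-X) below-X+T) ⟩
    P + (d′ * (3 * T) + (T + T + v))
      ≡⟨ rearrange T d′ v ⟩
    3 * d * T + (X + T + v) + 4 * T
      ≡⟨ cong (λ z → 3 * d * T + z + 4 * T) k+1≡X+T+v ⟨
    3 * d * T + (k + 1) + 4 * T ∎
    where
    open ≡-Reasoning
    v = suc k ∸ (X + T)
    X+T<1+k : X + T < suc k
    X+T<1+k = *-cancelˡ-< 2 _ _ (subst₂ _<_ (3*[2*t]≡2*[2*t+t] T) (cong (2 *_) (+-comm k 1)) 3X<2[k+1])
      where
      3*[2*t]≡2*[2*t+t] : ∀ t → 3 * (2 * t) ≡ 2 * (2 * t + t)
      3*[2*t]≡2*[2*t+t] = solve-∀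
    k+1≡X+T+v : k + 1 ≡ X + T + v
    k+1≡X+T+v = trans (+-comm k 1) (sym (m+[n∸m]≡n (<⇒≤ X+T<1+k)))
    1+k≤X+T+T : suc k ≤ X + T + T
    1+k≤X+T+T = ≤-trans (<⇒≤ 2+k≤2^[1+d]) (≤-reflexive (4*t≡2*t+t+t T))
      where
      4*t≡2*t+t+t : ∀ t → 2 * (2 * t) ≡ 2 * t + t + t
      4*t≡2*t+t+t = solve-∀
    below-X : countBelow X ≡ T
    below-X = trans (∑-count-< X T (suc k))
                    (m≥n⇒m⊓n≡n (m+n≤o⇒m≤o∸n T (subst (_≤ suc k) (+-comm X T) (<⇒≤ X+T<1+k))))
    below-X+T : countBelow (X + T) ≡ v
    below-X+T = trans (∑-count-< (X + T) T (suc k)) (m≤n⇒m⊓n≡m (m≤n+o⇒m∸n≤o (suc k) (X + T) 1+k≤X+T+T))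
    rearrange : ∀ t d′ v → 2 * (2 * (2 * t)) + (d′ * (3 * t) + (t + t + v))
                           ≡ 3 * (1 + d′) * t + (2 * t + t + v) + 4 * t
    rearrange = solve-∀

-- Averages

-- Imported only here: with ℤ's prefix +_ in scope, sections such as (m +_) no longer parse.
open import Data.Integer as ℤ using (+_; +[1+_]; _⊖_)
import Data.Integer.Properties as ℤP
import Data.Rational
open import Data.Rational as ℚ using (ℚ; mkℚ; _/_; toℚᵘ; 0ℚ)
import Data.Rational.Properties as ℚP
open import Data.Rational.Unnormalised as ℚᵘ using (mkℚᵘ; _≃_; *≡*; *<*)
import Data.Rational.Unnormalised.Properties as ℚᵘP

∣m⊖n∣≡∣m-n∣ : ∀ m n → ℤ.∣ m ⊖ n ∣ ≡ ∣ m - n ∣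
∣m⊖n∣≡∣m-n∣ m n with ≤-total m n
... | inj₁ m≤n = trans (ℤP.∣⊖∣-≤ m≤n) (sym (m≤n⇒∣m-n∣≡n∸m m≤n))
... | inj₂ n≤m = trans (ℤP.∣m⊖n∣≡∣n⊖m∣ m n) (trans (ℤP.∣⊖∣-≤ n≤m) (sym (m≤n⇒∣n-m∣≡n∸m n≤m)))

toℚᵘ-/ : ∀ a p .{{_ : NonZero p}} → toℚᵘ ((+ a) / p) ≃ mkℚᵘ (+ a) (pred p)
toℚᵘ-/ a (suc p) = ℚP.toℚᵘ-fromℚᵘ (mkℚᵘ (+ a) p)

toℚᵘ-∣S/N-L∣ : ∀ S m C P′ (L : ℚ) → toℚᵘ L ≃ mkℚᵘ (+ C) P′ →
               toℚᵘ ℚ.∣ (+ S) / suc m ℚ.- L ∣ ≃ mkℚᵘ (+ ∣ S * suc P′ - suc m * C ∣) (P′ + m * suc P′)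
toℚᵘ-∣S/N-L∣ S m C P′ L L≃C/P =
  ℚᵘP.≃-trans (ℚP.toℚᵘ-homo-∣-∣ ((+ S) / N ℚ.- L))
    (ℚᵘP.≃-trans (ℚᵘP.∣-∣-cong (ℚᵘP.≃-trans (ℚP.toℚᵘ-homo-+ ((+ S) / N) (ℚ.- L))
                                 (ℚᵘP.+-cong (toℚᵘ-/ S N) (ℚᵘP.≃-trans (ℚP.toℚᵘ-homo‿- L) (ℚᵘP.-‿cong L≃C/P)))))
      (ℚᵘP.≃-reflexive (cong (λ z → mkℚᵘ (+ z) (P′ + m * P))
        (trans (cong ℤ.∣_∣ numerator)
               (trans (∣m⊖n∣≡∣m-n∣ (S * P) (C * N)) (cong (∣ S * P -_∣) (*-comm C N)))))))
  where
  N = suc m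
  P = suc P′
  numerator : + S ℤ.* + P ℤ.+ ℤ.- (+ C) ℤ.* + N ≡ (S * P) ⊖ (C * N)
  numerator = begin
    + S ℤ.* + P ℤ.+ ℤ.- (+ C) ℤ.* + N ≡⟨ cong₂ ℤ._+_ (ℤP.pos-* S P) (ℤP.neg-distribˡ-* (+ C) (+ N)) ⟨
    + (S * P) ℤ.+ ℤ.- (+ C ℤ.* + N)   ≡⟨ cong (λ z → + (S * P) ℤ.+ ℤ.- z) (ℤP.pos-* C N) ⟨
    + (S * P) ℤ.+ ℤ.- (+ (C * N))     ≡⟨ ℤP.m-n≡m⊖n (S * P) (C * N) ⟩
    (S * P) ⊖ (C * N)                 ∎
    where open ≡-Reasoning

averages-converge : ∀ (s : ℕ → ℕ) {C P N₀ K} .{{_ : NonZero P}} (L : ℚ) →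
                    toℚᵘ L ≃ mkℚᵘ (+ C) (pred P) →
                    (∀ N → N₀ ≤ N → ∣ s N * P - N * C ∣ ≤ K) →
                    ∀ ε → 0ℚ ℚ.< ε → Σ ℕ λ M → ∀ m → M ≤ m → ℚ.∣ (+ s (suc m)) / suc m ℚ.- L ∣ ℚ.< ε
averages-converge s {P = suc _} L _ _ (mkℚ (+ 0)  _ _) (ℚ.*<* (ℤ.+<+ ()))
averages-converge s {P = suc _} L _ _ (mkℚ ℤ.-[1+ _ ] _ _) (ℚ.*<* ())
averages-converge s {C} {suc P′} {N₀} {K} L L≃C/P deviation ε@(mkℚ +[1+ e ] dε _) _ =
  K * suc dε + N₀ , close
  where
  -- For N = m + 1 ≥ M, the distance is D / (N * P) with D ≤ K, and K / N < 1 / (1 + dε) ≤ ε.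
  close : ∀ m → K * suc dε + N₀ ≤ m → ℚ.∣ (+ s (suc m)) / suc m ℚ.- L ∣ ℚ.< ε
  close m M≤m = ℚP.toℚᵘ-cancel-< (ℚᵘP.<-respˡ-≃ (ℚᵘP.≃-sym (toℚᵘ-∣S/N-L∣ (s N) m C P′ L L≃C/P))
                                   (*<* (subst₂ ℤ._<_ (ℤP.pos-* D (suc dε)) (ℤP.pos-* (suc e) (N * P)) (ℤ.+<+ cross))))
    where
    N = suc m
    P = suc P′
    D = ∣ s N * P - N * C ∣
    N₀≤N : N₀ ≤ N
    N₀≤N = ≤-trans (m≤n+m N₀ (K * suc dε)) (m≤n⇒m≤1+n M≤m)
    cross : D * suc dε < suc e * (N * P)
    cross = begin-strict
      D * suc dε      ≤⟨ *-monoˡ-≤ (suc dε) (deviation N N₀≤N) ⟩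
      K * suc dε      <⟨ s≤s (≤-trans (m≤m+n (K * suc dε) N₀) M≤m) ⟩
      N               ≤⟨ m≤m*n N P ⟩
      N * P           ≤⟨ m≤n*m (N * P) (suc e) ⟩
      suc e * (N * P) ∎
      where open ≤-Reasoning

+ᵘ-mkℚᵘ : ∀ a p b q → mkℚᵘ (+ a) p ℚᵘ.+ mkℚᵘ (+ b) q ≡ mkℚᵘ (+ (a * suc q + b * suc p)) (q + p * suc q)
+ᵘ-mkℚᵘ a p b q = cong (λ n → mkℚᵘ n (q + p * suc q))
  (trans (cong₂ ℤ._+_ (sym (ℤP.pos-* a (suc q))) (sym (ℤP.pos-* b (suc p))))
         (sym (ℤP.pos-+ (a * suc q) (b * suc p))))

mkℚᵘ-≃ : ∀ a b {x y} .{{_ : NonZero x}} .{{_ : NonZero y}} →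
         a * y ≡ b * x → mkℚᵘ (+ a) (pred x) ≃ mkℚᵘ (+ b) (pred y)
mkℚᵘ-≃ a b {suc x} {suc y} a*y≡b*x =
  *≡* (trans (sym (ℤP.pos-* a (suc y))) (trans (cong +_ a*y≡b*x) (ℤP.pos-* b (suc x))))

toℚᵘ-sum₃ : ∀ a b c p q r .{{_ : NonZero p}} .{{_ : NonZero q}} .{{_ : NonZero r}} →
            toℚᵘ ((+ a) / p ℚ.+ (+ b) / q ℚ.+ (+ c) / r)
              ≃ mkℚᵘ (+ ((a * q + b * p) * r + c * (p * q))) (pred (p * q * r))
toℚᵘ-sum₃ a b c (suc p) (suc q) (suc r) =
  ℚᵘP.≃-trans (ℚP.toℚᵘ-homo-+ (x ℚ.+ y) z)
    (ℚᵘP.≃-trans (ℚᵘP.+-cong (ℚᵘP.≃-trans (ℚP.toℚᵘ-homo-+ x y) (ℚᵘP.+-cong (toℚᵘ-/ a (suc p)) (toℚᵘ-/ b (suc q))))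
                             (toℚᵘ-/ c (suc r)))
      (ℚᵘP.≃-reflexive (trans (cong (ℚᵘ._+ mkℚᵘ (+ c) r) (+ᵘ-mkℚᵘ a p b q))
                              (+ᵘ-mkℚᵘ (a * suc q + b * suc p) (q + p * suc q) c r))))
  where
  x = (+ a) / suc p
  y = (+ b) / suc q
  z = (+ c) / suc r

module AmortizedBelt (k d′ : ℕ) (2^d≤k+1 : 2 ^ suc d′ ≤ k + 1) (k+1<2^[d+1] : k + 1 < 2 ^ (suc d′ + 1))
  where

  open NewestLeaf k d′ 2^d≤k+1 k+1<2^[d+1]

  instance
    _ = m^n≢0 2 (suc (suc d))
    _ = m^n≢0 2 (d + 1)
    _ = m^n≢0 2 (d + 2)
    _ = m*n≢0 (8 * 2 ^ (d + 1)) 8 {{m*n≢0 8 (2 ^ (d + 1))}}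
    _ = m*n≢0 (8 * 2 ^ (d + 2)) 2 {{m*n≢0 8 (2 ^ (d + 2))}}

  deviation : ∃ λ K → ∀ N → P ≤ N → ∣ ∑[ i < N ] b k (k + i) * P - N * ∑ P leafLabel ∣ ≤ K
  deviation = eventually-periodic-deviation leafLabel-periodic leafLabel-≤ P (suc (k + P)) tail
    where
    tail : ∀ i → b k (k + (P + i)) ≡ leafLabel (suc (k + P) + i)
    tail i = trans (b≡leafLabel (k + (P + i)) (≤-trans (m≤m+n P i) (≤-trans (m≤n+m (P + i) k) (n≤1+n _))))
                   (cong (leafLabel ∘ suc) (sym (+-assoc k P i)))

  amortized : ∀ L → toℚᵘ L ≃ mkℚᵘ (+ ∑ P leafLabel) (pred P) → AmortizedLimit k L
  amortized L L≃ = averages-converge (partialSum k) L L≃ (λ N P≤N →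
    subst (λ s → ∣ s * P - N * ∑ P leafLabel ∣ ≤ proj₁ deviation) (sym (partialSum≡∑ k N))
          (proj₂ deviation N P≤N))

  value-≤ : 2 * (k + 1) ≤ 3 * 2 ^ d →
            toℚᵘ ((+ (3 * d)) / 8 ℚ.+ (+ (k + 1)) / 2 ^ (d + 1) ℚ.+ (+ 1) / 8)
              ≃ mkℚᵘ (+ ∑ P leafLabel) (pred P)
  value-≤ h = ℚᵘP.≃-trans (toℚᵘ-sum₃ (3 * d) (k + 1) 1 8 q 8) (mkℚᵘ-≃ _ _ {8 * q * 8} {P} cross)
    where
    q = 2 ^ (d + 1)
    identity : ∀ d K t → ((3 * d * (2 * (2 * t)) + K * 8) * 8 + 1 * (8 * (2 * (2 * t)))) * (2 * (2 * (2 * t)))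
                         ≡ (3 * d * t + 2 * K + t) * (8 * (2 * (2 * t)) * 8)
    identity = solve-∀
    cross : ((3 * d * q + (k + 1) * 8) * 8 + 1 * (8 * q)) * P ≡ ∑ P leafLabel * (8 * q * 8)
    cross = subst₂ (λ x C → ((3 * d * x + (k + 1) * 8) * 8 + 1 * (8 * x)) * P ≡ C * (8 * x * 8))
                   (sym (cong (2 ^_) (+-comm d 1))) (sym (∑-leafLabel-≤ h)) (identity d (k + 1) T)
  value-> : 3 * 2 ^ d < 2 * (k + 1) →
            toℚᵘ ((+ (3 * d)) / 8 ℚ.+ (+ (k + 1)) / 2 ^ (d + 2) ℚ.+ (+ 1) / 2)
              ≃ mkℚᵘ (+ ∑ P leafLabel) (pred P)
  value-> h = ℚᵘP.≃-trans (toℚᵘ-sum₃ (3 * d) (k + 1) 1 8 q 2) (mkℚᵘ-≃ _ _ {8 * q * 2} {P} cross)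
    where
    q = 2 ^ (d + 2)
    identity : ∀ d K t → ((3 * d * (2 * (2 * (2 * t))) + K * 8) * 2 + 1 * (8 * (2 * (2 * (2 * t)))))
                           * (2 * (2 * (2 * t)))
                         ≡ (3 * d * t + K + 4 * t) * (8 * (2 * (2 * (2 * t))) * 2)
    identity = solve-∀
    cross : ((3 * d * q + (k + 1) * 8) * 2 + 1 * (8 * q)) * P ≡ ∑ P leafLabel * (8 * q * 2)
    cross = subst₂ (λ x C → ((3 * d * x + (k + 1) * 8) * 2 + 1 * (8 * x)) * P ≡ C * (8 * x * 2))
                   (sym (cong (2 ^_) (+-comm d 2))) (sym (∑-leafLabel-> h)) (identity d (k + 1) T)
lemma31 : (k d : ℕ) → 1 ≤ k → 2 ^ d ≤ k + 1 → k + 1 < 2 ^ (d + 1) →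
    (2 * (k + 1) ≤ 3 * 2 ^ d →
      AmortizedLimit k
        (Data.Rational._+_
          (Data.Rational._+_ ((+ (3 * d)) / 8)
            (_/_ (+ (k + 1)) (2 ^ (d + 1)) {{m^n≢0 2 (d + 1)}}))
          ((+ 1) / 8)))
    × (3 * 2 ^ d < 2 * (k + 1) →
      AmortizedLimit k
        (Data.Rational._+_
          (Data.Rational._+_ ((+ (3 * d)) / 8)
            (_/_ (+ (k + 1)) (2 ^ (d + 2)) {{m^n≢0 2 (d + 2)}}))
          ((+ 1) / 2)))
lemma31 k zero     1≤k _       k+1<2          = contradiction (+-monoˡ-≤ 1 1≤k) (<⇒≱ k+1<2)
lemma31 k (suc d′) _   2^d≤k+1 k+1<2^[d+1] = amortized _ ∘ value-≤ , amortized _ ∘ value->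
  where open AmortizedBelt k d′ 2^d≤k+1 k+1<2^[d+1]
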